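{- For every integer $b\geq 2$, the graph $K_{2,b}^{1/2}$ is locatable.
   Context: $K_{a,b}$ is the complete bipartite graph with parts of sizes $a$ and $b$. For a graph $G$ and positive integer $m$, $G^{1/m}$ denotes the graph obtained from $G$ by replacing each edge by a path of length $m$ through $m-1$ new vertices (so $K_{2,b}^{1/2}$ subdivides each edge once). The Robber Locating game on a finite connected graph: a robber occupies an (initially unknown) vertex. In each round the robber first either stays or moves to an adjacent vertex, and then the cop probes any vertex $v$ and is told the current distance from $v$ to the robber; there is no further restriction on the robber's moves. The cop wins if at some point she can determine the robber's current vertex uniquely. The robber is omniscient. A graph is locatable if the cop has a strategy guaranteed to win within a bounded number of rounds, equivalently one that wins against every robber behaviour. -}

module Defs where

open import Data.Nat using (ℕ; zero; suc; _≤_)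
open import Data.Bool using (Bool; true; false; _∧_; _∨_)
open import Data.Fin using (Fin)
import Data.Fin.Properties as FinP
open import Data.List using (List; []; _∷_; _++_; map; length; concatMap)
open import Data.Bool.ListAction using (any)
open import Data.Product using (_×_; _,_; ∃; ∃-syntax; Σ)
open import Data.Sum using (_⊎_)
open import Relation.Binary.PropositionalEquality using (_≡_; refl; cong; cong₂)
open import Relation.Binary.Definitions using (DecidableEquality)
open import Relation.Nullary using (yes; no; Dec)
open import Relation.Nullary.Decidable using (⌊_⌋)
open import Data.List.Base using (allFin)

record Graph : Set₁ where
  field
    V        : Set
    _≟V_     : DecidableEquality V
    vertices : List V            -- lists every vertex (used for distances)
    adj      : V → V → Bool

module GraphTheory (G : Graph) where
  open Graph G

  reach : ℕ → V → V → Bool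
  reach zero    u v = ⌊ u ≟V v ⌋
  reach (suc k) u v = reach k u v ∨ any (λ w → reach k u w ∧ adj w v) vertices

  -- graph distance: least k (with k < |V|) such that v is reachable from u
  -- by a walk of length ≤ k  (for connected graphs this is the usual
  -- shortest-path distance; the fallback value |V| only occurs for
  -- disconnected pairs)
  distFrom : ℕ → ℕ → V → V → ℕ
  distFrom k zero    u v = k
  distFrom k (suc f) u v with reach k u v
  ... | true  = k
  ... | false = distFrom (suc k) f u v

  dist : V → V → ℕ
  dist u v = distFrom 0 (length vertices) u v

  -- A robber walk is an infinite sequence of vertices w 0, w 1, ...:
  -- w 0 is the robber's initial (unknown) vertex and w (suc t) is his
  -- position in round (suc t), after he either stayed or moved to an
  -- adjacent vertex.
  IsRobberWalk : (ℕ → V) → Set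
  IsRobberWalk w = ∀ t → (w (suc t) ≡ w t) ⊎ (adj (w t) (w (suc t)) ≡ true)

  -- A (deterministic) cop strategy chooses the probe of the next round
  -- from the list of all answers received so far (most recent first).
  CopStrategy : Set
  CopStrategy = List ℕ → V

  answers : CopStrategy → (ℕ → V) → ℕ → List ℕ
  answers σ w zero    = []
  answers σ w (suc t) = dist (σ (answers σ w t)) (w (suc t)) ∷ answers σ w t

  Located : CopStrategy → (ℕ → V) → ℕ → Set
  Located σ w t = ∀ w′ → IsRobberWalk w′ → answers σ w′ t ≡ answers σ w t → w′ t ≡ w t

  Locatable : Set
  Locatable = ∃[ N ] Σ CopStrategy λ σ →
    ∀ w → IsRobberWalk w → ∃[ t ] (t ≤ N × Located σ w t)

-- The graph K_{2,b}^{1/2}: K_{2,b} has parts {hub 0, hub 1} and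
-- {leaf j | j : Fin b}; subdividing each edge hub i — leaf j once
-- introduces the new vertex sub i j, with edges hub i — sub i j — leaf j.

data K2bVtx (b : ℕ) : Set where
  hub  : Fin 2 → K2bVtx b
  leaf : Fin b → K2bVtx b
  sub  : Fin 2 → Fin b → K2bVtx b

_≟K_ : ∀ {b} → DecidableEquality (K2bVtx b)
hub i ≟K hub i′ with i FinP.≟ i′
... | yes refl = yes refl
... | no ne    = no λ { refl → ne refl }
hub i ≟K leaf j = no λ ()
hub i ≟K sub i′ j = no λ ()
leaf j ≟K hub i = no λ ()
leaf j ≟K leaf j′ with j FinP.≟ j′
... | yes refl = yes refl
... | no ne    = no λ { refl → ne refl }
leaf j ≟K sub i j′ = no λ ()
sub i j ≟K hub i′ = no λ ()
sub i j ≟K leaf j′ = no λ ()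
sub i j ≟K sub i′ j′ with i FinP.≟ i′ | j FinP.≟ j′
... | yes refl | yes refl = yes refl
... | no ne    | _        = no λ { refl → ne refl }
... | _        | no ne    = no λ { refl → ne refl }

K2bAdj : ∀ {b} → K2bVtx b → K2bVtx b → Bool
K2bAdj (hub i)   (sub i′ j)  = ⌊ i FinP.≟ i′ ⌋
K2bAdj (sub i j) (hub i′)    = ⌊ i FinP.≟ i′ ⌋
K2bAdj (sub i j) (leaf j′)   = ⌊ j FinP.≟ j′ ⌋
K2bAdj (leaf j)  (sub i j′)  = ⌊ j FinP.≟ j′ ⌋
K2bAdj _         _           = false

K2b-half : ℕ → Graph
K2b-half b = record
  { V        = K2bVtx b
  ; _≟V_     = _≟K_
  ; vertices = map hub (allFin 2) ++ map leaf (allFin b)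
               ++ concatMap (λ i → map (sub i) (allFin b)) (allFin 2)
  ; adj      = K2bAdj
  }

module Submission where

-- Write h₀, h₁ for the two hubs, ℓ_j for the leaves and s_{i,j} for the
-- subdivision vertex between h_i and ℓ_j; the branch of j is {ℓ_j, s_{0,j}, s_{1,j}}.
-- The cop alternates probes h₀, ℓ_0, h₀, ℓ_1, h₀, ℓ_2, …  Two cases:
--   * the robber stands on a hub at some time t: a probe of h₀ answers 0 or 4
--     and names the hub; a probe of ℓ_j answers 2 exactly on hubs, and the
--     preceding probe of h₀ saw the robber beside that hub (distance ≤ 1 or
--     ≥ 3), which again names the hub;
--   * otherwise the robber never leaves the branch B he starts in: the probe
--     of ℓ_B (distance ≤ 1) confines him to branch B, and the next probe of h₀
--     (distance 1, 2 or 3) pins down his vertex within that branch.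

open import Defs
open import Data.Nat using (ℕ; zero; suc; _≤_; _<_; z≤n; s≤s; _+_; _≤ᵇ_; _<?_)
open import Data.Nat.Properties
  using (≤-trans; ≤-refl; ≤-reflexive; ≤-antisym; n≤1+n; m≤n⇒m≤1+n; m≤n⇒m<n∨m≡n; <⇒≱;
         ≤ᵇ⇒≤; +-suc; +-identityʳ; m≤n+m)
open import Data.Bool using (true; false; T; if_then_else_)
open import Data.Bool.Properties using (T-∨; T-∧; T-≡)
open import Data.Fin using (Fin; zero; suc; toℕ; fromℕ<)
open import Data.Fin.Properties using (_≟_; toℕ<n; fromℕ<-toℕ)
open import Data.List using (List; []; _∷_; _++_; map; length; allFin; tabulate)
open import Data.List.Properties using (∷-injective; length-++)
open import Data.List.Membership.Propositional using (_∈_; lose)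
open import Data.List.Membership.Propositional.Properties
  using (∈-map⁺; ∈-++⁺ˡ; ∈-++⁺ʳ; ∈-concatMap⁺; ∈-allFin)
open import Data.List.Relation.Unary.Any using (here; there; satisfied)
open import Data.List.Relation.Unary.Any.Properties using (any⁺; any⁻)
open import Data.Product using (_×_; _,_; ∃)
open import Data.Sum using (_⊎_; inj₁; inj₂)
open import Data.Empty using (⊥-elim)
open import Function.Base using (_∘_)
open import Function.Bundles using (Equivalence)
open import Relation.Nullary using (Dec; yes; no; ¬_)
open import Relation.Nullary.Decidable using (⌊_⌋; toWitness; fromWitness)
open import Relation.Binary.PropositionalEquality
  using (_≡_; _≢_; refl; sym; trans; cong; subst; module ≡-Reasoning)

open Equivalence using (to; from)

≤-compute : ∀ {m n} {m≤n : T (m ≤ᵇ n)} → m ≤ n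
≤-compute {m} {n} {m≤n} = ≤ᵇ⇒≤ m n m≤n

3≰1 : ¬ 3 ≤ 1
3≰1 (s≤s ())

decided : ∀ {A : Set} (a? : Dec A) → ⌊ a? ⌋ ≡ true → A
decided a? e = toWitness (from T-≡ e)

accepted : ∀ {A : Set} (a? : Dec A) → A → ⌊ a? ⌋ ≡ true
accepted a? a = to T-≡ (fromWitness a)

∈⇒nonempty : ∀ {A : Set} {x : A} {xs} → x ∈ xs → 1 ≤ length xs
∈⇒nonempty (here _)  = s≤s z≤n
∈⇒nonempty (there _) = s≤s z≤n

length-++-≥ʳ : ∀ {A : Set} (xs : List A) {ys} → length ys ≤ length (xs ++ ys)
length-++-≥ʳ xs {ys} = subst (length ys ≤_) (sym (length-++ xs)) (m≤n+m (length ys) (length xs))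

-- A function f with f u = 0 that grows by
-- at most one along each edge, and such that every v is reachable from u in
-- f v steps, is the distance from u (provided f stays below the order of
-- the graph, which the fuel of `distFrom` requires).

module DistanceCertificate (G : Graph) where
  open Graph G
  open GraphTheory G

  Lipschitz : (V → ℕ) → Set
  Lipschitz f = ∀ x y → adj x y ≡ true → f y ≤ suc (f x)

  reach-refl : ∀ u → T (reach 0 u u)
  reach-refl u = fromWitness refl

  reach-step : ∀ {k u w v} → T (reach k u w) → adj w v ≡ true → w ∈ vertices →
               T (reach (suc k) u v)
  reach-step r a w∈ = from T-∨ (inj₂ (any⁺ _ (lose w∈ (from T-∧ (r , from T-≡ a)))))

  reach⇒≥ : ∀ {f u} → Lipschitz f → f u ≡ 0 → ∀ k v → T (reach k u v) → f v ≤ k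
  reach⇒≥ L fu zero v r with toWitness r
  ... | refl = ≤-reflexive fu
  reach⇒≥ L fu (suc k) v r with to T-∨ r
  ... | inj₁ r′ = m≤n⇒m≤1+n (reach⇒≥ L fu k v r′)
  ... | inj₂ r′ with satisfied (any⁻ _ vertices r′)
  ... | w , q with to T-∧ q
  ... | rw , a = ≤-trans (L w v (to T-≡ a)) (s≤s (reach⇒≥ L fu k w rw))

  distFrom-least : ∀ {u v d} → (∀ k → T (reach k u v) → d ≤ k) → T (reach d u v) →
                   ∀ fuel k → k ≤ d → d < k + fuel → distFrom k fuel u v ≡ d
  distFrom-least lower rd zero k k≤d d<k rewrite +-identityʳ k = ⊥-elim (<⇒≱ d<k k≤d)
  distFrom-least {u} {v} {d} lower rd (suc fuel) k k≤d d<k with reach k u v in eq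
  ... | true  = ≤-antisym k≤d (lower k (from T-≡ eq))
  ... | false = distFrom-least lower rd fuel (suc k) k<d (subst (d <_) (+-suc k fuel) d<k)
    where
      k<d : k < d
      k<d with m≤n⇒m<n∨m≡n k≤d
      ... | inj₁ k<d = k<d
      ... | inj₂ refl with trans (sym eq) (to T-≡ rd)
      ... | ()

  dist-certificate : ∀ {f u} → Lipschitz f → f u ≡ 0 → (∀ v → T (reach (f v) u v)) →
                     (∀ v → f v < length vertices) → ∀ v → dist u v ≡ f v
  dist-certificate L fu walk small v =
    distFrom-least (λ k → reach⇒≥ L fu k v) (walk v) (length vertices) 0 z≤n (small v)

module ObliviousStrategy (G : Graph) (probe : ℕ → Graph.V G) where
  open GraphTheory G

  strategy : CopStrategy
  strategy replies = probe (length replies)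

  answers-length : ∀ w t → length (answers strategy w t) ≡ t
  answers-length w zero    = refl
  answers-length w (suc t) = cong suc (answers-length w t)

  answers-suc : ∀ w t → answers strategy w (suc t) ≡ dist (probe t) (w (suc t)) ∷ answers strategy w t
  answers-suc w t = cong (λ r → dist (probe r) (w (suc t)) ∷ answers strategy w t) (answers-length w t)

  same-answer : ∀ {w w′} t → answers strategy w′ t ≡ answers strategy w t → ∀ {s} → s < t →
                dist (probe s) (w′ (suc s)) ≡ dist (probe s) (w (suc s))
  same-answer {w} {w′} (suc t) agree (s≤s s≤t)
    with ∷-injective (trans (sym (answers-suc w′ t)) (trans agree (answers-suc w t)))
  ... | now , before with m≤n⇒m<n∨m≡n s≤t
  ... | inj₁ s<t  = same-answer t before s<t
  ... | inj₂ refl = now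

  same-value : ∀ {w w′ t s p} {f : Graph.V G → ℕ} → (∀ v → dist p v ≡ f v) →
               answers strategy w′ t ≡ answers strategy w t → s < t → probe s ≡ p →
               f (w′ (suc s)) ≡ f (w (suc s))
  same-value {w} {w′} {t} {s} {f = f} distₚ agree s<t refl = begin
    f (w′ (suc s))                 ≡⟨ sym (distₚ _) ⟩
    dist (probe s) (w′ (suc s))    ≡⟨ same-answer t agree s<t ⟩
    dist (probe s) (w (suc s))     ≡⟨ distₚ _ ⟩
    f (w (suc s))                  ∎
    where open ≡-Reasoning

module K2bHalf (n : ℕ) where
  b : ℕ
  b = suc n

  V : Set
  V = K2bVtx b

  open Graph (K2b-half b) using (vertices)
  open GraphTheory (K2b-half b)
  open DistanceCertificate (K2b-half b)

  one : Fin 2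
  one = suc zero

  data Edge : V → V → Set where
    hs : ∀ i j → Edge (hub i) (sub i j)
    sh : ∀ i j → Edge (sub i j) (hub i)
    sl : ∀ i j → Edge (sub i j) (leaf j)
    ls : ∀ i j → Edge (leaf j) (sub i j)

  edge : ∀ {x y} → K2bAdj x y ≡ true → Edge x y
  edge {hub i}   {sub i′ j}  e with decided (i ≟ i′) e
  ... | refl = hs i j
  edge {sub i j} {hub i′}    e with decided (i ≟ i′) e
  ... | refl = sh i j
  edge {sub i j} {leaf j′}   e with decided (j ≟ j′) e
  ... | refl = sl i j
  edge {leaf j}  {sub i j′}  e with decided (j ≟ j′) e
  ... | refl = ls i j
  edge {hub _}   {hub _}  ()
  edge {hub _}   {leaf _} ()
  edge {leaf _}  {hub _}  ()
  edge {leaf _}  {leaf _} ()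
  edge {sub _ _} {sub _ _} ()

  edge-adj : ∀ {x y} → Edge x y → K2bAdj x y ≡ true
  edge-adj (hs i j) = accepted (i ≟ i) refl
  edge-adj (sh i j) = accepted (i ≟ i) refl
  edge-adj (sl i j) = accepted (j ≟ j) refl
  edge-adj (ls i j) = accepted (j ≟ j) refl

  edge-lipschitz : ∀ f → (∀ {x y} → Edge x y → f y ≤ suc (f x)) → Lipschitz f
  edge-lipschitz f L x y a = L (edge a)

  all-vertices : ∀ v → v ∈ vertices
  all-vertices (hub i)   = ∈-++⁺ˡ (∈-map⁺ hub (∈-allFin i))
  all-vertices (leaf j)  = ∈-++⁺ʳ (map hub (allFin 2)) (∈-++⁺ˡ (∈-map⁺ leaf (∈-allFin j)))
  all-vertices (sub i j) = ∈-++⁺ʳ (map hub (allFin 2)) (∈-++⁺ʳ (map leaf (allFin b))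
    (∈-concatMap⁺ (λ i′ → map (sub i′) (allFin b)) (lose (∈-allFin i) (∈-map⁺ (sub i) (∈-allFin j)))))

  -- The list evaluates to h₀ ∷ h₁ ∷ ℓ_0 ∷ (later leaves ++ s_{0,0} ∷ … ∷ s_{1,0} ∷ …).
  five≤order : 5 ≤ length vertices
  five≤order = s≤s (s≤s (s≤s (≤-trans two≤subs (length-++-≥ʳ (tail leaf)))))
    where
      tail : (Fin b → V) → List V
      tail f = map f (tabulate {n = n} suc)

      two≤subs : 2 ≤ length (sub zero zero ∷ tail (sub zero) ++ sub one zero ∷ tail (sub one) ++ [])
      two≤subs = s≤s (∈⇒nonempty (∈-++⁺ʳ (tail (sub zero)) (here refl)))

  within-order : ∀ {f : V → ℕ} → (∀ v → f v ≤ 4) → ∀ v → f v < length vertices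
  within-order f≤4 v = ≤-trans (s≤s (f≤4 v)) five≤order

  infixl 5 _▸_
  data Walk (u : V) : ℕ → V → Set where
    start : Walk u 0 u
    _▸_   : ∀ {k w v} → Walk u k w → Edge w v → Walk u (suc k) v

  walk-reach : ∀ {u k v} → Walk u k v → T (reach k u v)
  walk-reach {u} start = reach-refl u
  walk-reach {u} (_▸_ {k} {w} {v} p e) = reach-step {k} {u} {w} {v} (walk-reach p) (edge-adj e) (all-vertices w)

  level : V → ℕ
  level (hub zero)         = 0
  level (hub (suc zero))   = 4
  level (sub zero _)       = 1
  level (sub (suc zero) _) = 3
  level (leaf _)           = 2

  level-lipschitz : ∀ {x y} → Edge x y → level y ≤ suc (level x)
  level-lipschitz (hs zero _)       = ≤-compute
  level-lipschitz (hs (suc zero) _) = ≤-compute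
  level-lipschitz (sh zero _)       = ≤-compute
  level-lipschitz (sh (suc zero) _) = ≤-compute
  level-lipschitz (sl zero _)       = ≤-compute
  level-lipschitz (sl (suc zero) _) = ≤-compute
  level-lipschitz (ls zero _)       = ≤-compute
  level-lipschitz (ls (suc zero) _) = ≤-compute

  level≤4 : ∀ v → level v ≤ 4
  level≤4 (hub zero)         = ≤-compute
  level≤4 (hub (suc zero))   = ≤-compute
  level≤4 (sub zero _)       = ≤-compute
  level≤4 (sub (suc zero) _) = ≤-compute
  level≤4 (leaf _)           = ≤-compute

  level-walk : ∀ v → Walk (hub zero) (level v) v
  level-walk (hub zero)         = start
  level-walk (hub (suc zero))   = start ▸ hs zero zero ▸ sl zero zero ▸ ls one zero ▸ sh one zero
  level-walk (sub zero j)       = start ▸ hs zero j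
  level-walk (sub (suc zero) j) = start ▸ hs zero j ▸ sl zero j ▸ ls one j
  level-walk (leaf j)           = start ▸ hs zero j ▸ sl zero j

  dist-level : ∀ v → dist (hub zero) v ≡ level v
  dist-level = dist-certificate (edge-lipschitz level level-lipschitz) refl
                 (walk-reach ∘ level-walk) (within-order level≤4)

  fromLeaf : Fin b → V → ℕ
  fromLeaf j (hub _)   = 2
  fromLeaf j (leaf k)  = if ⌊ j ≟ k ⌋ then 0 else 4
  fromLeaf j (sub _ k) = if ⌊ j ≟ k ⌋ then 1 else 3

  fromLeaf-lipschitz : ∀ j {x y} → Edge x y → fromLeaf j y ≤ suc (fromLeaf j x)
  fromLeaf-lipschitz j (hs _ k) with ⌊ j ≟ k ⌋
  ... | true  = ≤-compute
  ... | false = ≤-compute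
  fromLeaf-lipschitz j (sh _ k) with ⌊ j ≟ k ⌋
  ... | true  = ≤-compute
  ... | false = ≤-compute
  fromLeaf-lipschitz j (sl _ k) with ⌊ j ≟ k ⌋
  ... | true  = ≤-compute
  ... | false = ≤-compute
  fromLeaf-lipschitz j (ls _ k) with ⌊ j ≟ k ⌋
  ... | true  = ≤-compute
  ... | false = ≤-compute

  fromLeaf≤4 : ∀ j v → fromLeaf j v ≤ 4
  fromLeaf≤4 j (hub _)   = ≤-compute
  fromLeaf≤4 j (leaf k)  with ⌊ j ≟ k ⌋
  ... | true  = ≤-compute
  ... | false = ≤-compute
  fromLeaf≤4 j (sub _ k) with ⌊ j ≟ k ⌋
  ... | true  = ≤-compute
  ... | false = ≤-compute

  fromLeaf-walk : ∀ j v → Walk (leaf j) (fromLeaf j v) v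
  fromLeaf-walk j (hub i) = start ▸ ls i j ▸ sh i j
  fromLeaf-walk j (leaf k) with j ≟ k
  ... | yes refl = start
  ... | no _     = start ▸ ls zero j ▸ sh zero j ▸ hs zero k ▸ sl zero k
  fromLeaf-walk j (sub i k) with j ≟ k
  ... | yes refl = start ▸ ls i j
  ... | no _     = start ▸ ls i j ▸ sh i j ▸ hs i k

  fromLeaf-tip : ∀ j → fromLeaf j (leaf j) ≡ 0
  fromLeaf-tip j = cong (λ c → if c then 0 else 4) (accepted (j ≟ j) refl)

  dist-fromLeaf : ∀ j v → dist (leaf j) v ≡ fromLeaf j v
  dist-fromLeaf j = dist-certificate (edge-lipschitz (fromLeaf j) (fromLeaf-lipschitz j)) (fromLeaf-tip j)
                      (walk-reach ∘ fromLeaf-walk j) (within-order (fromLeaf≤4 j))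

  Move : V → V → Set
  Move x y = (y ≡ x) ⊎ (K2bAdj x y ≡ true)

  IsHub : V → Set
  IsHub v = ∃ λ i → v ≡ hub i

  data InBranch (j : Fin b) : V → Set where
    spoke : ∀ i → InBranch j (sub i j)
    tip   : InBranch j (leaf j)

  hub-or-branch : ∀ v → IsHub v ⊎ ∃ λ j → InBranch j v
  hub-or-branch (hub i)   = inj₁ (i , refl)
  hub-or-branch (leaf j)  = inj₂ (j , tip)
  hub-or-branch (sub i j) = inj₂ (j , spoke i)

  branch-move : ∀ {j x y} → InBranch j x → Move x y → IsHub y ⊎ InBranch j y
  branch-move p (inj₁ refl) = inj₂ p
  branch-move p (inj₂ a)    = along p (edge a)
    where
      along : ∀ {j x y} → InBranch j x → Edge x y → IsHub y ⊎ InBranch j y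
      along (spoke _) (sh i _) = inj₁ (i , refl)
      along (spoke _) (sl _ _) = inj₂ tip
      along tip       (ls i _) = inj₂ (spoke i)

  data BesideHub (i : Fin 2) : V → Set where
    at     : BesideHub i (hub i)
    beside : ∀ j → BesideHub i (sub i j)

  move-to-hub : ∀ {x i} → Move x (hub i) → BesideHub i x
  move-to-hub (inj₁ refl) = at
  move-to-hub {x} {i} (inj₂ a) with edge {x} {hub i} a
  ... | sh _ j = beside j

  beside-h₀ : ∀ {x} → BesideHub zero x → level x ≤ 1
  beside-h₀ at         = z≤n
  beside-h₀ (beside _) = ≤-refl

  beside-h₁ : ∀ {x} → BesideHub one x → 3 ≤ level x
  beside-h₁ at         = ≤-compute
  beside-h₁ (beside _) = ≤-refl

  -- Positions beside h₀ have level ≤ 1, beside h₁ level ≥ 3: the level tells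
  -- which hub the robber is about to reach.
  beside-level : ∀ {i i′ x y} → BesideHub i x → BesideHub i′ y → level x ≡ level y → i ≡ i′
  beside-level {zero}     {zero}     _ _ _ = refl
  beside-level {suc zero} {suc zero} _ _ _ = refl
  beside-level {zero}     {suc zero} p q e = ⊥-elim (3≰1 (≤-trans (subst (3 ≤_) (sym e) (beside-h₁ q)) (beside-h₀ p)))
  beside-level {suc zero} {zero}     p q e = ⊥-elim (3≰1 (≤-trans (subst (3 ≤_) e (beside-h₁ p)) (beside-h₀ q)))

  level-hub : ∀ {v} i → level v ≡ level (hub i) → v ≡ hub i
  level-hub {hub zero}         zero       _  = refl
  level-hub {hub (suc zero)}   (suc zero) _  = refl
  level-hub {hub (suc zero)}   zero       ()
  level-hub {sub zero _}       zero       ()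
  level-hub {sub (suc zero) _} zero       ()
  level-hub {leaf _}           zero       ()
  level-hub {hub zero}         (suc zero) ()
  level-hub {sub zero _}       (suc zero) ()
  level-hub {sub (suc zero) _} (suc zero) ()
  level-hub {leaf _}           (suc zero) ()

  branch-level-not-hub : ∀ {j v} → InBranch j v → ∀ i → level (hub i) ≢ level v
  branch-level-not-hub (spoke zero)       zero       ()
  branch-level-not-hub (spoke zero)       (suc zero) ()
  branch-level-not-hub (spoke (suc zero)) zero       ()
  branch-level-not-hub (spoke (suc zero)) (suc zero) ()
  branch-level-not-hub tip                zero       ()
  branch-level-not-hub tip                (suc zero) ()

  branch-level-injective : ∀ {j x y} → InBranch j x → InBranch j y → level x ≡ level y → x ≡ y
  branch-level-injective (spoke zero)       (spoke zero)       _  = refl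
  branch-level-injective (spoke (suc zero)) (spoke (suc zero)) _  = refl
  branch-level-injective tip                tip                _  = refl
  branch-level-injective (spoke zero)       (spoke (suc zero)) ()
  branch-level-injective (spoke (suc zero)) (spoke zero)       ()
  branch-level-injective (spoke zero)       tip                ()
  branch-level-injective (spoke (suc zero)) tip                ()
  branch-level-injective tip                (spoke zero)       ()
  branch-level-injective tip                (spoke (suc zero)) ()

  fromLeaf-hub : ∀ j {v} → fromLeaf j v ≡ 2 → IsHub v
  fromLeaf-hub j {hub i} _ = i , refl
  fromLeaf-hub j {leaf k} e with ⌊ j ≟ k ⌋
  fromLeaf-hub j {leaf k} () | true
  fromLeaf-hub j {leaf k} () | false
  fromLeaf-hub j {sub _ k} e with ⌊ j ≟ k ⌋
  fromLeaf-hub j {sub _ k} () | true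
  fromLeaf-hub j {sub _ k} () | false

  branch⇒fromLeaf≤1 : ∀ {j v} → InBranch j v → fromLeaf j v ≤ 1
  branch⇒fromLeaf≤1 {j} (spoke _) = ≤-reflexive (cong (λ c → if c then 1 else 3) (accepted (j ≟ j) refl))
  branch⇒fromLeaf≤1 {j} tip       = subst (_≤ 1) (sym (fromLeaf-tip j)) z≤n

  fromLeaf≤1⇒branch : ∀ j {v} → fromLeaf j v ≤ 1 → InBranch j v
  fromLeaf≤1⇒branch j {hub _} (s≤s ())
  fromLeaf≤1⇒branch j {leaf k} d with j ≟ k
  ... | yes refl = tip
  fromLeaf≤1⇒branch j {leaf k} (s≤s ()) | no _
  fromLeaf≤1⇒branch j {sub i k} d with j ≟ k
  ... | yes refl = spoke i
  fromLeaf≤1⇒branch j {sub i k} (s≤s ()) | no _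

  -- The cop's schedule h₀, ℓ_0, h₀, ℓ_1, …, h₀, ℓ_{b-1}, then h₀ for ever;
  -- scheduleFrom k is the part of it starting at the probe of h₀ before ℓ_k.
  leafProbe : ℕ → V
  leafProbe m with m <? b
  ... | yes m<b = leaf (fromℕ< m<b)
  ... | no _    = hub zero

  leafProbe-cases : ∀ m → leafProbe m ≡ hub zero ⊎ ∃ λ j → leafProbe m ≡ leaf j
  leafProbe-cases m with m <? b
  ... | yes m<b = inj₂ (fromℕ< m<b , refl)
  ... | no _    = inj₁ refl

  leafProbe-toℕ : ∀ j → leafProbe (toℕ j) ≡ leaf j
  leafProbe-toℕ j with toℕ j <? b
  ... | yes j<b = cong leaf (fromℕ<-toℕ j j<b)
  ... | no j≮b  = ⊥-elim (j≮b (toℕ<n j))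

  scheduleFrom : ℕ → ℕ → V
  scheduleFrom k zero          = hub zero
  scheduleFrom k (suc zero)    = leafProbe k
  scheduleFrom k (suc (suc t)) = scheduleFrom (suc k) t

  probe : ℕ → V
  probe = scheduleFrom 0

  twice : ℕ → ℕ
  twice zero    = zero
  twice (suc m) = suc (suc (twice m))

  twice-mono : ∀ {m m′} → m ≤ m′ → twice m ≤ twice m′
  twice-mono z≤n       = z≤n
  twice-mono (s≤s m≤m′) = s≤s (s≤s (twice-mono m≤m′))

  scheduleFrom-even : ∀ k m → scheduleFrom k (twice m) ≡ hub zero
  scheduleFrom-even k zero    = refl
  scheduleFrom-even k (suc m) = scheduleFrom-even (suc k) m

  scheduleFrom-odd : ∀ k m → scheduleFrom k (suc (twice m)) ≡ leafProbe (k + m)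
  scheduleFrom-odd k zero    = cong leafProbe (sym (+-identityʳ k))
  scheduleFrom-odd k (suc m) = trans (scheduleFrom-odd (suc k) m) (cong leafProbe (sym (+-suc k m)))

  data Probed (k : ℕ) : ℕ → Set where
    hub-probe  : ∀ {t} → scheduleFrom k t ≡ hub zero → Probed k t
    leaf-probe : ∀ {t} j → scheduleFrom k (suc t) ≡ leaf j → scheduleFrom k t ≡ hub zero →
                 Probed k (suc t)

  probed : ∀ k t → Probed k t
  probed k zero = hub-probe refl
  probed k (suc zero) with leafProbe-cases k
  ... | inj₁ h₀-probe       = hub-probe h₀-probe
  ... | inj₂ (j , ℓ-probe)  = leaf-probe j ℓ-probe refl
  probed k (suc (suc t)) with probed (suc k) t
  ... | hub-probe h₀-probe             = hub-probe h₀-probe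
  ... | leaf-probe j ℓ-probe h₀-probe  = leaf-probe j ℓ-probe h₀-probe

  -- ℓ_j is probed in round leafTime j, and h₀ in the round after.
  leafTime : Fin b → ℕ
  leafTime j = suc (suc (twice (toℕ j)))

  leaf-round : ∀ j → probe (suc (twice (toℕ j))) ≡ leaf j
  leaf-round j = trans (scheduleFrom-odd 0 (toℕ j)) (leafProbe-toℕ j)

  open ObliviousStrategy (K2b-half b) probe

  locate-at-hub : ∀ {w r i} → IsRobberWalk w → w (suc r) ≡ hub i → Located strategy w (suc r)
  locate-at-hub {w} {r} {i} W at-hub w′ W′ agree with probed 0 r
  ... | hub-probe h₀-probe =
    trans (level-hub i (trans (same-value dist-level agree ≤-refl h₀-probe) (cong level at-hub))) (sym at-hub)
  ... | leaf-probe {r′} j ℓ-probe h₀-probe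
    with fromLeaf-hub j (trans (same-value (dist-fromLeaf j) agree ≤-refl ℓ-probe) (cong (fromLeaf j) at-hub))
  ... | i′ , at-hub′ = trans at-hub′ (trans (cong hub same-hub) (sym at-hub))
    where
      same-hub : i′ ≡ i
      same-hub = beside-level (move-to-hub (subst (Move (w′ (suc r′))) at-hub′ (W′ (suc r′))))
                              (move-to-hub (subst (Move (w (suc r′))) at-hub (W (suc r′))))
                              (same-value dist-level agree (n≤1+n _) h₀-probe)

  locate-in-branch : ∀ {w} j → InBranch j (w (leafTime j)) → InBranch j (w (suc (leafTime j))) →
                     Located strategy w (suc (leafTime j))
  locate-in-branch {w} j p q w′ W′ agree = branch-level-injective q′ q same-level
    where
      same-level : level (w′ (suc (leafTime j))) ≡ level (w (suc (leafTime j)))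
      same-level = same-value dist-level agree ≤-refl (scheduleFrom-even 0 (suc (toℕ j)))

      p′ : InBranch j (w′ (leafTime j))
      p′ = fromLeaf≤1⇒branch j (subst (_≤ 1)
             (sym (same-value (dist-fromLeaf j) agree (n≤1+n _) (leaf-round j))) (branch⇒fromLeaf≤1 p))

      q′ : InBranch j (w′ (suc (leafTime j)))
      q′ with branch-move p′ (W′ (leafTime j))
      ... | inj₁ (i , e)  = ⊥-elim (branch-level-not-hub q i (trans (cong level (sym e)) same-level))
      ... | inj₂ q′       = q′

  HubVisitBy : (ℕ → V) → ℕ → Set
  HubVisitBy w t = ∃ λ r → suc r ≤ t × IsHub (w (suc r))

  confined : ∀ {w j} → IsRobberWalk w → InBranch j (w 1) → ∀ t → HubVisitBy w (suc t) ⊎ InBranch j (w (suc t))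
  confined W p zero = inj₂ p
  confined W p (suc t) with confined W p t
  ... | inj₁ (r , r<t , h) = inj₁ (r , m≤n⇒m≤1+n r<t , h)
  ... | inj₂ q with branch-move q (W (suc t))
  ... | inj₁ h  = inj₁ (suc t , ≤-refl , h)
  ... | inj₂ q′ = inj₂ q′

  rounds : ℕ
  rounds = suc (twice b)

  last-round : ∀ j → suc (leafTime j) ≤ rounds
  last-round j = s≤s (twice-mono (toℕ<n j))

  win-at-hub : ∀ {w t} → IsRobberWalk w → HubVisitBy w t → t ≤ rounds →
               ∃ λ t → t ≤ rounds × Located strategy w t
  win-at-hub W (r , r<t , _ , at-hub) t≤rounds = suc r , ≤-trans r<t t≤rounds , locate-at-hub W at-hub

  win : ∀ w → IsRobberWalk w → ∃ λ t → t ≤ rounds × Located strategy w t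
  win w W with hub-or-branch (w 1)
  ... | inj₁ (_ , at-hub) = 1 , s≤s z≤n , locate-at-hub W at-hub
  ... | inj₂ (j , p) with confined W p (suc (twice (toℕ j))) | confined W p (leafTime j)
  ... | inj₁ visit | _          = win-at-hub W visit (≤-trans (n≤1+n _) (last-round j))
  ... | inj₂ _     | inj₁ visit = win-at-hub W visit (last-round j)
  ... | inj₂ p₁    | inj₂ p₂    = suc (leafTime j) , last-round j , locate-in-branch j p₁ p₂

  locatable : Locatable
  locatable = rounds , strategy , win

mainTheorem7 : ∀ (b : ℕ) → 2 ≤ b → GraphTheory.Locatable (K2b-half b)
-- The strategy above works as soon as b ≥ 1.
mainTheorem7 zero    ()
mainTheorem7 (suc n) _ = K2bHalf.locatable n
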